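{- Let $m\ge5$ be an integer and let $x,y$ be distinct nonzero elements of $\mathbb{Z}_m$ such that the cyclic Haar graph $\mathrm{H}(m,x,y)$ is connected. Then $\mathrm{H}(m,x,y)$ is a circulant if and only if $m$ is odd and $\{x,y\}=\{a,2a\}$ or $\{x,y\}=\{a,-a\}$ for some $a\in\mathbb{Z}$ with $\gcd(m,a)=1$.
   Context: The cyclic Haar graph $\mathrm{H}(m,x,y)$ has vertex set $\mathbb{Z}_m\times\mathbb{Z}_2$ and edges $\{(i,0),(i+t,1)\}$ for $i\in\mathbb{Z}_m$, $t\in\{0,x,y\}$. A graph is a circulant if it admits an automorphism that cyclically permutes all of its vertices (i.e. a semiregular automorphism with a single orbit; equivalently it is a Cayley graph of a cyclic group). -}

module Defs where

open import Data.Nat using (ℕ; zero; suc; _+_; _*_; _∸_; NonZero)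
open import Data.Nat.DivMod using (_mod_)
open import Data.Fin using (Fin; toℕ)
open import Data.Bool using (Bool; true; false)
open import Data.Product using (_×_; _,_; Σ; ∃-syntax)
open import Data.Sum using (_⊎_)
open import Data.Integer using (ℤ; _%ℕ_)
open import Function.Bundles using (_↔_; Inverse)
open import Relation.Binary.PropositionalEquality using (_≡_)
open import Relation.Nullary using (¬_)

-- ℤ_m represented by Fin m, with arithmetic mod m
module _ (m : ℕ) .{{_ : NonZero m}} where

  infixl 6 _⊕_
  _⊕_ : Fin m → Fin m → Fin m
  i ⊕ j = (toℕ i + toℕ j) mod m

  ⊖ : Fin m → Fin m
  ⊖ i = (m ∸ toℕ i) mod m

  dbl : Fin m → Fin m
  dbl i = (2 * toℕ i) mod m

  ι : ℤ → Fin m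
  ι a = (a %ℕ m) mod m

  -- vertices of the cyclic Haar graph: ℤ_m × ℤ_2  (false = 0, true = 1)
  Vertex : Set
  Vertex = Fin m × Bool

  -- edges {(i,0),(i+t,1)}, t ∈ {0,x,y}
  HaarEdge : Fin m → Fin m → Fin m → Fin m → Set
  HaarEdge x y i j = (j ≡ i) ⊎ (j ≡ i ⊕ x) ⊎ (j ≡ i ⊕ y)

  Adj : Fin m → Fin m → Vertex → Vertex → Set
  Adj x y (i , false) (j , true)  = HaarEdge x y i j
  Adj x y (i , true)  (j , false) = HaarEdge x y j i
  Adj x y (_ , false) (_ , false) = Data.Empty.⊥
    where import Data.Empty
  Adj x y (_ , true)  (_ , true)  = Data.Empty.⊥
    where import Data.Empty

module _ {V : Set} (E : V → V → Set) where

  data Walk : V → V → Set where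
    here : ∀ {u} → Walk u u
    step : ∀ {u v w} → E u v → Walk v w → Walk u w

  Connected : Set
  Connected = ∀ u v → Walk u v

  IsAutomorphism : V ↔ V → Set
  IsAutomorphism σ = ∀ u v → (E u v → E (to u) (to v)) × (E (to u) (to v) → E u v)
    where open Inverse σ using (to)

  iter : (V → V) → ℕ → V → V
  iter g zero v = v
  iter g (suc k) v = g (iter g k v)

  -- circulant: some automorphism cyclically permutes all vertices
  -- (its cyclic group acts transitively, i.e. it has a single orbit)
  IsCirculant : Set
  IsCirculant = Σ (V ↔ V) λ σ → IsAutomorphism σ ×
                  (∀ u v → ∃[ k ] iter (Inverse.to σ) k u ≡ v)

module Submission where

-- If m is odd and the offset set S = {0, x, y} satisfies S = d − S, the map
-- (i, 0) ↦ (i + c, 1), (j, 1) ↦ (j + e, 0) with c − e = d and c + e = 1 is an automorphism whose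
-- square is the translation by 1, hence it cycles all 2m vertices; S = d − S holds exactly when
-- y = 2x, x = 2y or y = −x.
-- Conversely, let g be an automorphism cycling all vertices and v_k = gᵏ(0, 0). By connectivity g
-- swaps the two sides, and g has period 2m. The exponents k of the three neighbours v_k of v_0 are
-- permuted by k ↦ 2m − k, so one of them is m; as v_m lies on the other side, m is odd. If v_k = (0, 1)
-- and v_l = (x, 1), then v_(k+l) is a common neighbour of both, and a common neighbour of (0, 1) and
-- (x, 1) other than v_0 forces y = 2x, x = 2y or y = −x (similarly with y if v_(k+l) = v_0).
-- Finally, any common divisor of m, x and y is preserved along walks, so it divides 1.

open import Algebra.Bundles using (AbelianGroup)
import Algebra.Properties.CommutativeSemigroup as CommutativeSemigroupProperties
open import Algebra.Structures using (IsAbelianGroup)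
open import Data.Bool using (Bool; true; false; not; _xor_)
import Data.Bool.Properties as Bool
open import Data.Empty using (⊥-elim)
open import Data.Fin using (Fin; toℕ; fromℕ<) renaming (zero to 0F)
open import Data.Fin.Properties
  using (toℕ-injective; toℕ<n; toℕ-fromℕ<; fromℕ<-injective; cantor-schröder-bernstein; 2↔Bool; *↔×)
  renaming (_≟_ to _≟ᶠ_)
open import Data.Integer using (ℤ; ∣_∣)
import Data.Integer as ℤ
open import Data.List using (List; []; _∷_; map)
open import Data.List.Membership.Propositional using (_∈_)
open import Data.List.Membership.Propositional.Properties using (∈-map⁺; ∈-map⁻)
import Data.List.Relation.Binary.Permutation.Propositional as ↭
open import Data.List.Relation.Binary.Permutation.Propositional.Properties using (∈-resp-↭)
open import Data.List.Relation.Unary.Any using (here; there)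
open import Data.Nat using (ℕ; NonZero; zero; suc; _+_; _*_; _∸_; _<_; _≤_; _%_; _/_; s≤s; z≤n)
open import Data.Nat.DivMod
open import Data.Nat.Divisibility
  using (_∣_; divides; _∣0; ∣1⇒≡1; ∣m∣n⇒∣m+n; ∣m+n∣m⇒∣n; %-presˡ-∣; m%n≡0⇒n∣m)
open import Data.Nat.GCD using (gcd; gcd[m,n]∣m; gcd[m,n]∣n)
open import Data.Nat.Properties
open import Data.Nat.Tactic.RingSolver using (solve-∀)
open import Data.Product using (_×_; _,_; ∃-syntax; proj₁; proj₂)
open import Data.Product.Function.NonDependent.Propositional using (_×-↔_)
open import Data.Product.Properties using (≡-dec)
open import Data.Sum using (_⊎_; inj₁; inj₂)
open import Function.Base using (_∘_)
open import Function.Bundles using (_↔_; _⇔_; Inverse; Injection; mk↔ₛ′; mk⇔)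
open import Function.Properties.Inverse using (↔-refl; ↔-sym; ↔-trans; ↔⇒↣)
open import Level using (0ℓ)
open import Relation.Binary.Definitions using (DecidableEquality; tri<; tri≈; tri>)
open import Relation.Binary.PropositionalEquality
  using (_≡_; _≢_; refl; sym; trans; cong; cong₂; subst; subst₂; module ≡-Reasoning)
open import Relation.Binary.PropositionalEquality.Algebra using (isMagma)
open import Relation.Nullary using (¬_; yes; no; contradiction)
open import Relation.Unary using (Decidable)

open import Defs

least-witness : {P : ℕ → Set} → Decidable P → ∀ {n} → P n → ∃[ k ] P k × (∀ {i} → i < k → ¬ P i)
least-witness {P} P? {n} Pn with search (suc n)
  where
    search : ∀ b → (∀ {i} → i < b → ¬ P i) ⊎ ∃[ k ] P k × (∀ {i} → i < k → ¬ P i)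
    search zero = inj₁ λ ()
    search (suc b) with search b
    ... | inj₂ least = inj₂ least
    ... | inj₁ none with P? b
    ...   | yes Pb = inj₂ (b , Pb , none)
    ...   | no ¬Pb = inj₁ λ i<1+b → case (m<1+n⇒m<n∨m≡n i<1+b)
      where
        case : ∀ {i} → i < b ⊎ i ≡ b → ¬ P i
        case (inj₁ i<b)  = none i<b
        case (inj₂ refl) = ¬Pb
... | inj₁ none  = contradiction Pn (none ≤-refl)
... | inj₂ least = least

module _ {A : Set} {a b c : A} (r : A → A)
         (involutive : ∀ {z} → z ∈ a ∷ b ∷ c ∷ [] → r (r z) ≡ z) where

  private
    swap : ∀ {z w} → z ∈ a ∷ b ∷ c ∷ [] → r z ≡ w → r w ≡ z
    swap z∈ rz≡w = trans (cong r (sym rz≡w)) (involutive z∈)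

    ∈a : a ∈ a ∷ b ∷ c ∷ []
    ∈a = here refl
    ∈b : b ∈ a ∷ b ∷ c ∷ []
    ∈b = there (here refl)
    ∈c : c ∈ a ∷ b ∷ c ∷ []
    ∈c = there (there (here refl))

  involution-fixes-one-of-three : a ≢ b → a ≢ c → b ≢ c →
    (∀ {z} → z ∈ a ∷ b ∷ c ∷ [] → r z ∈ a ∷ b ∷ c ∷ []) →
    ∃[ z ] z ∈ a ∷ b ∷ c ∷ [] × r z ≡ z
  involution-fixes-one-of-three a≢b a≢c b≢c closed with closed ∈a
  ... | here ra≡a = a , ∈a , ra≡a
  ... | there (here ra≡b) with closed ∈c
  ...   | there (there (here rc≡c)) = c , ∈c , rc≡c
  ...   | here rc≡a                 = contradiction (trans (sym ra≡b) (swap ∈c rc≡a)) b≢c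
  ...   | there (here rc≡b)         = contradiction (trans (sym (swap ∈a ra≡b)) (swap ∈c rc≡b)) a≢c
  involution-fixes-one-of-three a≢b a≢c b≢c closed | there (there (here ra≡c)) with closed ∈b
  ...   | there (here rb≡b)         = b , ∈b , rb≡b
  ...   | here rb≡a                 = contradiction (trans (sym ra≡c) (swap ∈b rb≡a)) (b≢c ∘ sym)
  ...   | there (there (here rb≡c)) = contradiction (trans (sym (swap ∈a ra≡c)) (swap ∈b rb≡c)) a≢b

module ℤmod (n : ℕ) where

  m : ℕ
  m = suc n

  ℤₘ : Set
  ℤₘ = Fin m

  infixl 6 _+ₘ_
  _+ₘ_ : ℤₘ → ℤₘ → ℤₘ
  _+ₘ_ = _⊕_ m

  -ₘ_ : ℤₘ → ℤₘ
  -ₘ_ = ⊖ m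

  0ₘ 1ₘ : ℤₘ
  0ₘ = 0F
  1ₘ = 1 mod m

  [_] : ℕ → ℤₘ
  [ k ] = k mod m

  toℕ-[] : ∀ k → toℕ [ k ] ≡ k % m
  toℕ-[] k = toℕ-fromℕ< _

  [toℕ] : ∀ a → [ toℕ a ] ≡ a
  [toℕ] a = toℕ-injective (trans (toℕ-[] (toℕ a)) (m<n⇒m%n≡m (toℕ<n a)))

  [%] : ∀ k → [ k % m ] ≡ [ k ]
  [%] k = toℕ-injective (trans (toℕ-[] (k % m)) (trans (m%n%n≡m%n k m) (sym (toℕ-[] k))))

  [+] : ∀ a b → [ a + b ] ≡ [ a ] +ₘ [ b ]
  [+] a b = toℕ-injective (begin
    toℕ [ a + b ]                        ≡⟨ toℕ-[] (a + b) ⟩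
    (a + b) % m                          ≡⟨ %-distribˡ-+ a b m ⟩
    (a % m + b % m) % m                  ≡⟨ cong₂ (λ u v → (u + v) % m) (toℕ-[] a) (toℕ-[] b) ⟨
    (toℕ [ a ] + toℕ [ b ]) % m          ≡⟨ toℕ-[] (toℕ [ a ] + toℕ [ b ]) ⟨
    toℕ ([ a ] +ₘ [ b ])                 ∎)
    where open ≡-Reasoning

  [+*m] : ∀ a k → [ a + k * m ] ≡ [ a ]
  [+*m] a k = toℕ-injective (trans (toℕ-[] (a + k * m)) (trans ([m+kn]%n≡m%n a k m) (sym (toℕ-[] a))))

  +ₘ-comm : ∀ a b → a +ₘ b ≡ b +ₘ a
  +ₘ-comm a b = cong [_] (+-comm (toℕ a) (toℕ b))

  +ₘ-assoc : ∀ a b c → (a +ₘ b) +ₘ c ≡ a +ₘ (b +ₘ c)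
  +ₘ-assoc a b c = begin
    (a +ₘ b) +ₘ c                  ≡⟨ cong ((a +ₘ b) +ₘ_) ([toℕ] c) ⟨
    [ toℕ a + toℕ b ] +ₘ [ toℕ c ]  ≡⟨ [+] (toℕ a + toℕ b) (toℕ c) ⟨
    [ toℕ a + toℕ b + toℕ c ]       ≡⟨ cong [_] (+-assoc (toℕ a) (toℕ b) (toℕ c)) ⟩
    [ toℕ a + (toℕ b + toℕ c) ]     ≡⟨ [+] (toℕ a) (toℕ b + toℕ c) ⟩
    [ toℕ a ] +ₘ (b +ₘ c)           ≡⟨ cong (_+ₘ (b +ₘ c)) ([toℕ] a) ⟩
    a +ₘ (b +ₘ c)                  ∎
    where open ≡-Reasoning

  +ₘ-identityˡ : ∀ a → 0ₘ +ₘ a ≡ a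
  +ₘ-identityˡ = [toℕ]

  +ₘ-identityʳ : ∀ a → a +ₘ 0ₘ ≡ a
  +ₘ-identityʳ a = trans (+ₘ-comm a 0ₘ) (+ₘ-identityˡ a)

  +ₘ-inverseʳ : ∀ a → a +ₘ -ₘ a ≡ 0ₘ
  +ₘ-inverseʳ a = begin
    a +ₘ -ₘ a                   ≡⟨ cong (_+ₘ -ₘ a) ([toℕ] a) ⟨
    [ toℕ a ] +ₘ [ m ∸ toℕ a ]  ≡⟨ [+] (toℕ a) (m ∸ toℕ a) ⟨
    [ toℕ a + (m ∸ toℕ a) ]     ≡⟨ cong [_] (trans (m+[n∸m]≡n (<⇒≤ (toℕ<n a))) (sym (*-identityˡ m))) ⟩
    [ 0 + 1 * m ]               ≡⟨ [+*m] 0 1 ⟩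
    0ₘ                          ∎
    where open ≡-Reasoning

  +ₘ-inverseˡ : ∀ a → -ₘ a +ₘ a ≡ 0ₘ
  +ₘ-inverseˡ a = trans (+ₘ-comm (-ₘ a) a) (+ₘ-inverseʳ a)

  +ₘ-isAbelianGroup : IsAbelianGroup _≡_ _+ₘ_ 0ₘ -ₘ_
  +ₘ-isAbelianGroup = record
    { isGroup = record
      { isMonoid = record
        { isSemigroup = record { isMagma = isMagma _+ₘ_ ; assoc = +ₘ-assoc }
        ; identity = +ₘ-identityˡ , +ₘ-identityʳ
        }
      ; inverse = +ₘ-inverseˡ , +ₘ-inverseʳ
      ; ⁻¹-cong = cong -ₘ_
      }
    ; comm = +ₘ-comm
    }

  +ₘ-abelianGroup : AbelianGroup 0ℓ 0ℓ
  +ₘ-abelianGroup = record { isAbelianGroup = +ₘ-isAbelianGroup }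

  [*%] : ∀ c k → [ c * (k % m) ] ≡ [ c * k ]
  [*%] c k = toℕ-injective (begin
    toℕ [ c * (k % m) ]           ≡⟨ toℕ-[] (c * (k % m)) ⟩
    c * (k % m) % m               ≡⟨ %-distribˡ-* c (k % m) m ⟩
    (c % m) * (k % m % m) % m     ≡⟨ cong (λ u → (c % m) * u % m) (m%n%n≡m%n k m) ⟩
    (c % m) * (k % m) % m         ≡⟨ %-distribˡ-* c k m ⟨
    c * k % m                     ≡⟨ toℕ-[] (c * k) ⟨
    toℕ [ c * k ]                 ∎)
    where open ≡-Reasoning

  ι-toℕ : ∀ a → ι m (ℤ.+ toℕ a) ≡ a
  ι-toℕ a = trans ([%] (toℕ a)) ([toℕ] a)

  dbl≡+ₘ : ∀ a → dbl m a ≡ a +ₘ a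
  dbl≡+ₘ a = cong [_] (cong (toℕ a +_) (+-identityʳ (toℕ a)))

  module _ {d : ℕ} (d∣m : d ∣ m) where

    ∣-[] : ∀ {k} → d ∣ k → d ∣ toℕ [ k ]
    ∣-[] {k} d∣k = subst (d ∣_) (sym (toℕ-[] k)) (%-presˡ-∣ d∣k d∣m)

    ∣-+ₘ : ∀ {a b} → d ∣ toℕ a → d ∣ toℕ b → d ∣ toℕ (a +ₘ b)
    ∣-+ₘ d∣a d∣b = ∣-[] (∣m∣n⇒∣m+n d∣a d∣b)

    ∣--ₘ : ∀ {a} → d ∣ toℕ a → d ∣ toℕ (-ₘ a)
    ∣--ₘ {a} d∣a = ∣-[] (∣m+n∣m⇒∣n (subst (d ∣_) (sym (m+[n∸m]≡n (<⇒≤ (toℕ<n a)))) d∣m) d∣a)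

  open import Algebra.Properties.AbelianGroup +ₘ-abelianGroup
    using (inverseʳ-unique; ⁻¹-involutive; identityˡ-unique; identityʳ-unique)

  DoubleOrNegation : ℤₘ → ℤₘ → Set
  DoubleOrNegation a b = b ≡ a +ₘ a ⊎ a ≡ b +ₘ b ⊎ b ≡ -ₘ a

  DoubleOrNegation-swap : ∀ {a b} → DoubleOrNegation a b → DoubleOrNegation b a
  DoubleOrNegation-swap (inj₁ b≡2a)              = inj₂ (inj₁ b≡2a)
  DoubleOrNegation-swap (inj₂ (inj₁ a≡2b))       = inj₁ a≡2b
  DoubleOrNegation-swap {a} (inj₂ (inj₂ b≡-a)) =
    inj₂ (inj₂ (trans (sym (⁻¹-involutive a)) (cong -ₘ_ (sym b≡-a))))

  module Halving (m-odd : ¬ 2 ∣ m) where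

    m≡1+[m/2]*2 : m ≡ 1 + (m / 2) * 2
    m≡1+[m/2]*2 with m % 2 | m%n<n m 2 | m≡m%n+[m/n]*n m 2 | m%n≡0⇒n∣m m 2
    ... | 0 | _                 | _  | 2∣m = ⊥-elim (m-odd (2∣m refl))
    ... | 1 | _                 | eq | _   = eq
    ... | suc (suc _) | s≤s (s≤s ()) | _ | _

    half : ℤₘ → ℤₘ
    half a = [ suc (m / 2) * toℕ a ]

    half-+ₘ-half : ∀ a → half a +ₘ half a ≡ a
    half-+ₘ-half a = begin
      half a +ₘ half a          ≡⟨ [+] (h * t) (h * t) ⟨
      [ h * t + h * t ]         ≡⟨ cong [_] (trans (lemma (m / 2) t) (cong (λ u → t + t * u) (sym m≡1+[m/2]*2))) ⟩
      [ t + t * m ]             ≡⟨ [+*m] t t ⟩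
      [ t ]                     ≡⟨ [toℕ] a ⟩
      a                         ∎
      where
        open ≡-Reasoning
        h = suc (m / 2)
        t = toℕ a
        lemma : ∀ q t → suc q * t + suc q * t ≡ t + t * (1 + q * 2)
        lemma = solve-∀

    half-+ₘ : ∀ a b → half (a +ₘ b) ≡ half a +ₘ half b
    half-+ₘ a b = begin
      [ h * toℕ [ toℕ a + toℕ b ] ]   ≡⟨ cong (λ u → [ h * u ]) (toℕ-[] (toℕ a + toℕ b)) ⟩
      [ h * ((toℕ a + toℕ b) % m) ]   ≡⟨ [*%] h (toℕ a + toℕ b) ⟩
      [ h * (toℕ a + toℕ b) ]         ≡⟨ cong [_] (*-distribˡ-+ h (toℕ a) (toℕ b)) ⟩
      [ h * toℕ a + h * toℕ b ]       ≡⟨ [+] (h * toℕ a) (h * toℕ b) ⟩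
      half a +ₘ half b                ∎
      where
        open ≡-Reasoning
        h = suc (m / 2)

    +ₘ-self≡0⇒≡0 : ∀ a → a +ₘ a ≡ 0ₘ → a ≡ 0ₘ
    +ₘ-self≡0⇒≡0 a a+a≡0 = begin
      a                  ≡⟨ half-+ₘ-half a ⟨
      half a +ₘ half a   ≡⟨ half-+ₘ a a ⟨
      half (a +ₘ a)      ≡⟨ cong half a+a≡0 ⟩
      half 0ₘ            ≡⟨ cong [_] (*-zeroʳ (suc (m / 2))) ⟩
      0ₘ                 ∎
      where open ≡-Reasoning

    offset-sum⇒DoubleOrNegation : ∀ {a b s′ s} → a ≢ 0ₘ → b ≢ 0ₘ → a ≢ b →
      s′ ∈ a ∷ b ∷ [] → s ∈ 0ₘ ∷ a ∷ b ∷ [] → a +ₘ s′ ≡ s → DoubleOrNegation a b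
    offset-sum⇒DoubleOrNegation {a} a≢0 _ _ (here refl) (here refl) a+a≡0 =
      contradiction (+ₘ-self≡0⇒≡0 a a+a≡0) a≢0
    offset-sum⇒DoubleOrNegation {a} a≢0 _ _ (here refl) (there (here refl)) a+a≡a =
      contradiction (identityʳ-unique a a a+a≡a) a≢0
    offset-sum⇒DoubleOrNegation _ _ _ (here refl) (there (there (here refl))) a+a≡b =
      inj₁ (sym a+a≡b)
    offset-sum⇒DoubleOrNegation {a} {b} _ _ _ (there (here refl)) (here refl) a+b≡0 =
      inj₂ (inj₂ (inverseʳ-unique a b a+b≡0))
    offset-sum⇒DoubleOrNegation {a} {b} _ b≢0 _ (there (here refl)) (there (here refl)) a+b≡a =
      contradiction (identityʳ-unique a b a+b≡a) b≢0
    offset-sum⇒DoubleOrNegation {a} {b} a≢0 _ _ (there (here refl)) (there (there (here refl))) a+b≡b =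
      contradiction (identityˡ-unique a b a+b≡b) a≢0

module Iteration {V : Set} (E : V → V → Set) where

  infix 10 _^_
  _^_ : (V → V) → ℕ → V → V
  _^_ = iter E

  ^-+ : ∀ g a b v → (g ^ (a + b)) v ≡ (g ^ a) ((g ^ b) v)
  ^-+ g zero    b v = refl
  ^-+ g (suc a) b v = cong g (^-+ g a b v)

  ^-suc′ : ∀ g k v → (g ^ k) (g v) ≡ (g ^ suc k) v
  ^-suc′ g k v = trans (sym (^-+ g k 1 v)) (cong (λ i → (g ^ i) v) (+-comm k 1))

  after-one-step : ∀ {g} v {w} → ∃[ k ] (g ^ k) (g v) ≡ w → ∃[ k ] (g ^ k) v ≡ w
  after-one-step {g} v (k , eq) = suc k , trans (sym (^-suc′ g k v)) eq

  ^-injective : ∀ {g} → (∀ {a b} → g a ≡ g b → a ≡ b) → ∀ k {a b} → (g ^ k) a ≡ (g ^ k) b → a ≡ b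
  ^-injective g-inj zero    eq = eq
  ^-injective g-inj (suc k) eq = ^-injective g-inj k (g-inj eq)

  ^-preserves : ∀ {g} → (∀ {a b} → E a b → E (g a) (g b)) → ∀ k {a b} → E a b → E ((g ^ k) a) ((g ^ k) b)
  ^-preserves g-pres zero    e = e
  ^-preserves g-pres (suc k) e = g-pres (^-preserves g-pres k e)

  ^-shift-preserves : ∀ {g} → (∀ {a b} → E a b → E (g a) (g b)) → ∀ a b {u} →
                      E u ((g ^ b) u) → E ((g ^ a) u) ((g ^ (a + b)) u)
  ^-shift-preserves {g} g-pres a b {u} e = subst (E ((g ^ a) u)) (sym (^-+ g a b u)) (^-preserves g-pres a e)

  module Orbit (_≟_ : DecidableEquality V) (g : V → V) (g-injective : ∀ {a b} → g a ≡ g b → a ≡ b)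
               (transitive : ∀ v w → ∃[ k ] (g ^ k) v ≡ w) (u : V) where

    private
      returns : ℕ → Set
      returns k = (g ^ suc k) u ≡ u

      returns-eventually : returns (proj₁ (transitive (g u) u))
      returns-eventually = trans (sym (^-suc′ g (proj₁ (transitive (g u) u)) u)) (proj₂ (transitive (g u) u))

      first-return : ∃[ k ] returns k × (∀ {i} → i < k → ¬ returns i)
      first-return = least-witness {P = returns} (λ k → (g ^ suc k) u ≟ u)
                                   {proj₁ (transitive (g u) u)} returns-eventually

    period : ℕ
    period = suc (proj₁ first-return)

    ^period : (g ^ period) u ≡ u
    ^period = proj₁ (proj₂ first-return)

    no-return-before-period : ∀ {i} → 0 < i → i < period → (g ^ i) u ≢ u
    no-return-before-period {suc i} _ (s≤s i<p) = proj₂ (proj₂ first-return) i<p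

    private
      ≢-below-period : ∀ {a b} → a < b → b < period → (g ^ a) u ≢ (g ^ b) u
      ≢-below-period {a} {b} a<b b<p gᵃu≡gᵇu =
        no-return-before-period (m<n⇒0<n∸m a<b) (≤-<-trans (m∸n≤m b a) b<p)
          (sym (^-injective g-injective a (begin
            (g ^ a) u                     ≡⟨ gᵃu≡gᵇu ⟩
            (g ^ b) u                     ≡⟨ cong (λ k → (g ^ k) u) (m+[n∸m]≡n (<⇒≤ a<b)) ⟨
            (g ^ (a + (b ∸ a))) u         ≡⟨ ^-+ g a (b ∸ a) u ⟩
            (g ^ a) ((g ^ (b ∸ a)) u)     ∎)))
        where open ≡-Reasoning

    ^-injective-below-period : ∀ {a b} → a < period → b < period → (g ^ a) u ≡ (g ^ b) u → a ≡ b
    ^-injective-below-period {a} {b} a<p b<p eq with <-cmp a b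
    ... | tri< a<b _ _ = contradiction eq (≢-below-period a<b b<p)
    ... | tri≈ _ a≡b _ = a≡b
    ... | tri> _ _ b<a = contradiction (sym eq) (≢-below-period b<a a<p)

    ^-%-period : ∀ k → (g ^ k) u ≡ (g ^ (k % period)) u
    ^-%-period k = begin
      (g ^ k) u                                       ≡⟨ cong (λ i → (g ^ i) u) (m≡m%n+[m/n]*n k period) ⟩
      (g ^ (k % period + (k / period) * period)) u    ≡⟨ ^-+ g (k % period) ((k / period) * period) u ⟩
      (g ^ (k % period)) ((g ^ ((k / period) * period)) u) ≡⟨ cong (g ^ (k % period)) (^-multiple (k / period)) ⟩
      (g ^ (k % period)) u                            ∎
      where
        open ≡-Reasoning
        ^-multiple : ∀ q → (g ^ (q * period)) u ≡ u
        ^-multiple zero    = refl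
        ^-multiple (suc q) = trans (^-+ g period (q * period) u) (trans (cong (g ^ period) (^-multiple q)) ^period)

    index : V → ℕ
    index v = proj₁ (transitive u v) % period

    index<period : ∀ v → index v < period
    index<period v = m%n<n (proj₁ (transitive u v)) period

    ^index : ∀ v → (g ^ index v) u ≡ v
    ^index v = trans (sym (^-%-period (proj₁ (transitive u v)))) (proj₂ (transitive u v))

    index-^ : ∀ {k} → k < period → index ((g ^ k) u) ≡ k
    index-^ k<p = ^-injective-below-period (index<period _) k<p (^index _)

    index-injective : ∀ {v w} → index v ≡ index w → v ≡ w
    index-injective {v} {w} eq = trans (sym (^index v)) (trans (cong (λ k → (g ^ k) u) eq) (^index w))

    period≡size : ∀ {N} → V ↔ Fin N → period ≡ N
    period≡size {N} V↔Fin = cantor-schröder-bernstein {f = orbit} {g = position} orbit-injective position-injective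
      where
        open Inverse V↔Fin using (to; from)
        orbit : Fin period → Fin N
        orbit a = to ((g ^ toℕ a) u)
        position : Fin N → Fin period
        position c = fromℕ< (index<period (from c))
        orbit-injective : ∀ {a b} → orbit a ≡ orbit b → a ≡ b
        orbit-injective eq = toℕ-injective (^-injective-below-period (toℕ<n _) (toℕ<n _)
          (Injection.injective (↔⇒↣ V↔Fin) eq))
        position-injective : ∀ {c d} → position c ≡ position d → c ≡ d
        position-injective {c} {d} eq = Injection.injective (↔⇒↣ (↔-sym V↔Fin))
          (index-injective (fromℕ<-injective _ _ (index<period (from c)) (index<period (from d)) eq))

  module Sides (side : V → Bool) (edge-flips : ∀ {a b} → E a b → side b ≡ not (side a))
               {g : V → V} (g-preserves : ∀ {a b} → E a b → E (g a) (g b)) where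

    walk-preserves-side-shift : ∀ c {u v} → Walk E u v → side (g u) ≡ side u xor c → side (g v) ≡ side v xor c
    walk-preserves-side-shift c here              shift = shift
    walk-preserves-side-shift c (step {u} {v} e w) shift = walk-preserves-side-shift c w (begin
      side (g v)              ≡⟨ edge-flips (g-preserves e) ⟩
      not (side (g u))        ≡⟨ cong not shift ⟩
      not (side u xor c)      ≡⟨ Bool.not-distribˡ-xor (side u) c ⟩
      not (side u) xor c      ≡⟨ cong (_xor c) (edge-flips e) ⟨
      side v xor c            ∎)
      where open ≡-Reasoning

    ^-preserves-sides : (∀ v → side (g v) ≡ side v) → ∀ k v → side ((g ^ k) v) ≡ side v
    ^-preserves-sides g-keeps zero    v = refl
    ^-preserves-sides g-keeps (suc k) v = trans (g-keeps _) (^-preserves-sides g-keeps k v)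

    even-^-preserves-sides : (∀ v → side (g v) ≡ not (side v)) → ∀ q v → side ((g ^ (q * 2)) v) ≡ side v
    even-^-preserves-sides g-flips zero    v = refl
    even-^-preserves-sides g-flips (suc q) v = begin
      side (g (g ((g ^ (q * 2)) v)))    ≡⟨ g-flips _ ⟩
      not (side (g ((g ^ (q * 2)) v)))  ≡⟨ cong not (g-flips _) ⟩
      not (not (side ((g ^ (q * 2)) v))) ≡⟨ Bool.not-involutive _ ⟩
      side ((g ^ (q * 2)) v)            ≡⟨ even-^-preserves-sides g-flips q v ⟩
      side v                            ∎
      where open ≡-Reasoning

module Haar (n : ℕ) (x y : Fin (suc n)) where

  open ℤmod n
  open Iteration (Adj m x y)
  open import Algebra.Properties.AbelianGroup +ₘ-abelianGroup
    using (x≈z//y; ∙-cancelʳ; \\-leftDividesˡ; //-rightDividesˡ; //-rightDividesʳ)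
  open CommutativeSemigroupProperties (AbelianGroup.commutativeSemigroup +ₘ-abelianGroup)
    using (interchange; xy∙z≈y∙xz)

  Offsets : List ℤₘ
  Offsets = 0ₘ ∷ x ∷ y ∷ []

  edge⇒offset : ∀ {i j} → HaarEdge m x y i j → ∃[ t ] t ∈ Offsets × j ≡ i +ₘ t
  edge⇒offset {i} (inj₁ j≡i)        = 0ₘ , here refl , trans j≡i (sym (+ₘ-identityʳ i))
  edge⇒offset (inj₂ (inj₁ j≡i+x))   = x , there (here refl) , j≡i+x
  edge⇒offset (inj₂ (inj₂ j≡i+y))   = y , there (there (here refl)) , j≡i+y

  offset⇒edge : ∀ {i j t} → t ∈ Offsets → j ≡ i +ₘ t → HaarEdge m x y i j
  offset⇒edge {i} (here refl)                 j≡i+0 = inj₁ (trans j≡i+0 (+ₘ-identityʳ i))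
  offset⇒edge (there (here refl))             j≡i+x = inj₂ (inj₁ j≡i+x)
  offset⇒edge (there (there (here refl)))     j≡i+y = inj₂ (inj₂ j≡i+y)

  Vertex↔Fin : Vertex m ↔ Fin (m * 2)
  Vertex↔Fin = ↔-trans (↔-refl ×-↔ ↔-sym 2↔Bool) (↔-sym *↔×)

  _≟ᵥ_ : DecidableEquality (Vertex m)
  _≟ᵥ_ = ≡-dec _≟ᶠ_ Bool._≟_

  origin : Vertex m
  origin = 0ₘ , false

  adj-sym : ∀ {u v} → Adj m x y u v → Adj m x y v u
  adj-sym {_ , false} {_ , true}  e = e
  adj-sym {_ , true}  {_ , false} e = e

  adj-flips : ∀ {u v} → Adj m x y u v → proj₂ v ≡ not (proj₂ u)
  adj-flips {_ , false} {_ , true}  _ = refl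
  adj-flips {_ , true}  {_ , false} _ = refl

  module _ {d : ℕ} (d∣m : d ∣ m) (d∣x : d ∣ toℕ x) (d∣y : d ∣ toℕ y) where

    ∣-offset : ∀ {t} → t ∈ Offsets → d ∣ toℕ t
    ∣-offset (here refl)             = d ∣0
    ∣-offset (there (here refl))     = d∣x
    ∣-offset (there (there (here refl))) = d∣y

    ∣-along-walk : ∀ {u v} → Walk (Adj m x y) u v → d ∣ toℕ (proj₁ u) → d ∣ toℕ (proj₁ v)
    ∣-along-walk here               d∣u = d∣u
    ∣-along-walk (step {u} {v} e w) d∣u = ∣-along-walk w (∣-edge u v e d∣u)
      where
        ∣-edge : ∀ u v → Adj m x y u v → d ∣ toℕ (proj₁ u) → d ∣ toℕ (proj₁ v)
        ∣-edge (i , false) (j , true) e d∣i with edge⇒offset e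
        ... | t , t∈ , j≡i+t = subst (λ k → d ∣ toℕ k) (sym j≡i+t) (∣-+ₘ d∣m d∣i (∣-offset t∈))
        ∣-edge (j , true) (i , false) e d∣j with edge⇒offset e
        ... | t , t∈ , j≡i+t = subst (λ k → d ∣ toℕ k) (sym (x≈z//y i t j (sym j≡i+t)))
                                 (∣-+ₘ d∣m d∣j (∣--ₘ d∣m (∣-offset t∈)))

    connected⇒common-divisor≡1 : Connected (Adj m x y) → 1 < m → d ≡ 1
    connected⇒common-divisor≡1 conn 1<m = ∣1⇒≡1 (subst (d ∣_) (trans (toℕ-[] 1) (m<n⇒m%n≡m 1<m))
      (∣-along-walk (conn origin (1ₘ , false)) (d ∣0)))

  common-neighbour : ∀ {q a} → HaarEdge m x y q 0ₘ → HaarEdge m x y q a → q ≢ 0ₘ →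
                     ∃[ s′ ] ∃[ s ] s′ ∈ x ∷ y ∷ [] × s ∈ Offsets × a +ₘ s′ ≡ s
  common-neighbour {q} {a} e₀ eₐ q≢0 with edge⇒offset e₀ | edge⇒offset eₐ
  ... | _  , here refl , 0≡q+0 | _ = contradiction (trans (sym (+ₘ-identityʳ q)) (sym 0≡q+0)) q≢0
  ... | s′ , there s′∈ , 0≡q+s′ | s , s∈ , a≡q+s = s′ , s , s′∈ , s∈ , (begin
    a +ₘ s′          ≡⟨ cong (_+ₘ s′) a≡q+s ⟩
    q +ₘ s +ₘ s′     ≡⟨ xy∙z≈y∙xz q s s′ ⟩
    s +ₘ (q +ₘ s′)   ≡⟨ cong (s +ₘ_) 0≡q+s′ ⟨
    s +ₘ 0ₘ          ≡⟨ +ₘ-identityʳ s ⟩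
    s                ∎)
    where open ≡-Reasoning

  DoubleOrNegationOf : ℤ → Set
  DoubleOrNegationOf a =
    ((x ≡ ι m a × y ≡ dbl m (ι m a)) ⊎ (y ≡ ι m a × x ≡ dbl m (ι m a))) ⊎
    ((x ≡ ι m a × y ≡ ⊖ m (ι m a)) ⊎ (y ≡ ι m a × x ≡ ⊖ m (ι m a)))

  DoubleOrNegationOf⇒DoubleOrNegation : ∀ {a} → DoubleOrNegationOf a → DoubleOrNegation x y
  DoubleOrNegationOf⇒DoubleOrNegation (inj₁ (inj₁ (x≡a , y≡2a))) =
    inj₁ (trans y≡2a (trans (cong (dbl m) (sym x≡a)) (dbl≡+ₘ x)))
  DoubleOrNegationOf⇒DoubleOrNegation (inj₁ (inj₂ (y≡a , x≡2a))) =
    inj₂ (inj₁ (trans x≡2a (trans (cong (dbl m) (sym y≡a)) (dbl≡+ₘ y))))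
  DoubleOrNegationOf⇒DoubleOrNegation (inj₂ (inj₁ (x≡a , y≡-a))) =
    inj₂ (inj₂ (trans y≡-a (cong -ₘ_ (sym x≡a))))
  DoubleOrNegationOf⇒DoubleOrNegation (inj₂ (inj₂ (y≡a , x≡-a))) =
    DoubleOrNegation-swap (inj₂ (inj₂ (trans x≡-a (cong -ₘ_ (sym y≡a)))))

  module _ (conn : Connected (Adj m x y)) (1<m : 1 < m) where

    gcd-offset≡1 : (a : ℤₘ) → (∀ {d} → d ∣ m → d ∣ toℕ a → (d ∣ toℕ x) × (d ∣ toℕ y)) →
                   gcd m ∣ ℤ.+ toℕ a ∣ ≡ 1
    gcd-offset≡1 a divides-offsets = connected⇒common-divisor≡1 d∣m (proj₁ d∣xy) (proj₂ d∣xy) conn 1<m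
      where
        d∣m = gcd[m,n]∣m m (toℕ a)
        d∣xy = divides-offsets d∣m (gcd[m,n]∣n m (toℕ a))

    DoubleOrNegation⇒coprime-witness : DoubleOrNegation x y → ∃[ a ] (gcd m ∣ a ∣ ≡ 1 × DoubleOrNegationOf a)
    DoubleOrNegation⇒coprime-witness (inj₁ y≡2x) =
      ℤ.+ toℕ x ,
      gcd-offset≡1 x (λ {d} d∣m d∣x → d∣x , subst (λ k → d ∣ toℕ k) (sym y≡2x) (∣-+ₘ d∣m d∣x d∣x)) ,
      inj₁ (inj₁ (sym (ι-toℕ x) , trans y≡2x (trans (sym (dbl≡+ₘ x)) (cong (dbl m) (sym (ι-toℕ x))))))
    DoubleOrNegation⇒coprime-witness (inj₂ (inj₁ x≡2y)) =
      ℤ.+ toℕ y ,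
      gcd-offset≡1 y (λ {d} d∣m d∣y → subst (λ k → d ∣ toℕ k) (sym x≡2y) (∣-+ₘ d∣m d∣y d∣y) , d∣y) ,
      inj₁ (inj₂ (sym (ι-toℕ y) , trans x≡2y (trans (sym (dbl≡+ₘ y)) (cong (dbl m) (sym (ι-toℕ y))))))
    DoubleOrNegation⇒coprime-witness (inj₂ (inj₂ y≡-x)) =
      ℤ.+ toℕ x ,
      gcd-offset≡1 x (λ {d} d∣m d∣x → d∣x , subst (λ k → d ∣ toℕ k) (sym y≡-x) (∣--ₘ d∣m d∣x)) ,
      inj₂ (inj₁ (sym (ι-toℕ x) , trans y≡-x (cong -ₘ_ (sym (ι-toℕ x)))))

  SymmetricAbout : ℤₘ → Set
  SymmetricAbout d = ∀ {t} → t ∈ Offsets → ∃[ t′ ] t′ ∈ Offsets × t +ₘ t′ ≡ d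

  DoubleOrNegation⇒symmetric-offsets : DoubleOrNegation x y → ∃[ d ] SymmetricAbout d
  DoubleOrNegation⇒symmetric-offsets (inj₁ y≡2x) = y , λ where
    (here refl)                 → y , there (there (here refl)) , +ₘ-identityˡ y
    (there (here refl))         → x , there (here refl) , sym y≡2x
    (there (there (here refl))) → 0ₘ , here refl , +ₘ-identityʳ y
  DoubleOrNegation⇒symmetric-offsets (inj₂ (inj₁ x≡2y)) = x , λ where
    (here refl)                 → x , there (here refl) , +ₘ-identityˡ x
    (there (here refl))         → 0ₘ , here refl , +ₘ-identityʳ x
    (there (there (here refl))) → y , there (there (here refl)) , sym x≡2y
  DoubleOrNegation⇒symmetric-offsets (inj₂ (inj₂ y≡-x)) = 0ₘ , λ where
    (here refl)                 → 0ₘ , here refl , +ₘ-identityˡ 0ₘ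
    (there (here refl))         → y , there (there (here refl)) , trans (cong (x +ₘ_) y≡-x) (+ₘ-inverseʳ x)
    (there (there (here refl))) → x , there (here refl) , trans (cong (_+ₘ x) y≡-x) (+ₘ-inverseˡ x)

  module Glide (m-odd : ¬ 2 ∣ m) (d : ℤₘ) (symmetric : SymmetricAbout d) where

    open Halving m-odd

    e c : ℤₘ
    e = half (1ₘ +ₘ -ₘ d)
    c = e +ₘ d

    c+e≡1 : c +ₘ e ≡ 1ₘ
    c+e≡1 = begin
      e +ₘ d +ₘ e                ≡⟨ xy∙z≈y∙xz e d e ⟩
      d +ₘ (e +ₘ e)              ≡⟨ cong (d +ₘ_) (half-+ₘ-half (1ₘ +ₘ -ₘ d)) ⟩
      d +ₘ (1ₘ +ₘ -ₘ d)          ≡⟨ +ₘ-comm d (1ₘ +ₘ -ₘ d) ⟩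
      1ₘ +ₘ -ₘ d +ₘ d            ≡⟨ //-rightDividesˡ d 1ₘ ⟩
      1ₘ                         ∎
      where open ≡-Reasoning

    glide unglide : Vertex m → Vertex m
    glide (i , false) = i +ₘ c , true
    glide (j , true)  = j +ₘ e , false
    unglide (j , true)  = j +ₘ -ₘ c , false
    unglide (i , false) = i +ₘ -ₘ e , true

    glide↔ : Vertex m ↔ Vertex m
    glide↔ = mk↔ₛ′ glide unglide glide-unglide unglide-glide
      where
        glide-unglide : ∀ v → glide (unglide v) ≡ v
        glide-unglide (i , false) = cong (_, false) (//-rightDividesˡ e i)
        glide-unglide (j , true)  = cong (_, true) (//-rightDividesˡ c j)
        unglide-glide : ∀ v → unglide (glide v) ≡ v
        unglide-glide (i , false) = cong (_, false) (//-rightDividesʳ c i)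
        unglide-glide (j , true)  = cong (_, true) (//-rightDividesʳ e j)

    edge⇒glided-edge : ∀ {i j} → HaarEdge m x y i j → HaarEdge m x y (j +ₘ e) (i +ₘ c)
    edge⇒glided-edge {i} {j} edge with edge⇒offset edge
    ... | t , t∈ , j≡i+t with symmetric t∈
    ...   | t′ , t′∈ , t+t′≡d = offset⇒edge t′∈ (begin
      i +ₘ (e +ₘ d)              ≡⟨ +ₘ-assoc i e d ⟨
      i +ₘ e +ₘ d                ≡⟨ cong (i +ₘ e +ₘ_) t+t′≡d ⟨
      i +ₘ e +ₘ (t +ₘ t′)        ≡⟨ interchange i e t t′ ⟩
      i +ₘ t +ₘ (e +ₘ t′)        ≡⟨ +ₘ-assoc (i +ₘ t) e t′ ⟨
      i +ₘ t +ₘ e +ₘ t′          ≡⟨ cong (λ k → k +ₘ e +ₘ t′) j≡i+t ⟨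
      j +ₘ e +ₘ t′               ∎)
      where open ≡-Reasoning

    glided-edge⇒edge : ∀ {i j} → HaarEdge m x y (j +ₘ e) (i +ₘ c) → HaarEdge m x y i j
    glided-edge⇒edge {i} {j} edge with edge⇒offset edge
    ... | s , s∈ , i+c≡j+e+s with symmetric s∈
    ...   | s′ , s′∈ , s+s′≡d = offset⇒edge s′∈ (sym (∙-cancelʳ (e +ₘ s) (i +ₘ s′) j (begin
      i +ₘ s′ +ₘ (e +ₘ s)        ≡⟨ interchange i s′ e s ⟩
      i +ₘ e +ₘ (s′ +ₘ s)        ≡⟨ cong (i +ₘ e +ₘ_) (trans (+ₘ-comm s′ s) s+s′≡d) ⟩
      i +ₘ e +ₘ d                ≡⟨ +ₘ-assoc i e d ⟩
      i +ₘ (e +ₘ d)              ≡⟨ i+c≡j+e+s ⟩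
      j +ₘ e +ₘ s                ≡⟨ +ₘ-assoc j e s ⟩
      j +ₘ (e +ₘ s)              ∎)))
      where open ≡-Reasoning

    glide-automorphism : IsAutomorphism (Adj m x y) glide↔
    glide-automorphism (i , false) (j , true)  = edge⇒glided-edge , glided-edge⇒edge
    glide-automorphism (j , true)  (i , false) = edge⇒glided-edge , glided-edge⇒edge
    glide-automorphism (_ , false) (_ , false) = (λ ()) , (λ ())
    glide-automorphism (_ , true)  (_ , true)  = (λ ()) , (λ ())

    glide² : ∀ i b → glide (glide (i , b)) ≡ (i +ₘ 1ₘ , b)
    glide² i false = cong (_, false) (trans (+ₘ-assoc i c e) (cong (i +ₘ_) c+e≡1))
    glide² i true  = cong (_, true) (trans (+ₘ-assoc i e c) (cong (i +ₘ_) (trans (+ₘ-comm e c) c+e≡1)))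

    glide^even : ∀ k i b → (glide ^ (k * 2)) (i , b) ≡ (i +ₘ [ k ] , b)
    glide^even zero    i b = cong (_, b) (sym (+ₘ-identityʳ i))
    glide^even (suc k) i b = begin
      glide (glide ((glide ^ (k * 2)) (i , b)))  ≡⟨ cong (glide ∘ glide) (glide^even k i b) ⟩
      glide (glide (i +ₘ [ k ] , b))             ≡⟨ glide² (i +ₘ [ k ]) b ⟩
      (i +ₘ [ k ] +ₘ 1ₘ , b)                     ≡⟨ cong (_, b) (+ₘ-assoc i [ k ] 1ₘ) ⟩
      (i +ₘ ([ k ] +ₘ [ 1 ]) , b)                ≡⟨ cong (λ a → i +ₘ a , b) ([+] k 1) ⟨
      (i +ₘ [ k + 1 ] , b)                       ≡⟨ cong (λ a → i +ₘ [ a ] , b) (+-comm k 1) ⟩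
      (i +ₘ [ suc k ] , b)                       ∎
      where open ≡-Reasoning

    glide-same-side : ∀ i j b → ∃[ k ] (glide ^ k) (i , b) ≡ (j , b)
    glide-same-side i j b = toℕ (-ₘ i +ₘ j) * 2 , (begin
      (glide ^ (toℕ (-ₘ i +ₘ j) * 2)) (i , b)  ≡⟨ glide^even (toℕ (-ₘ i +ₘ j)) i b ⟩
      (i +ₘ [ toℕ (-ₘ i +ₘ j) ] , b)           ≡⟨ cong (λ a → i +ₘ a , b) ([toℕ] (-ₘ i +ₘ j)) ⟩
      (i +ₘ (-ₘ i +ₘ j) , b)                   ≡⟨ cong (_, b) (\\-leftDividesˡ i j) ⟩
      (j , b)                                  ∎)
      where open ≡-Reasoning

    glide-transitive : ∀ v w → ∃[ k ] (glide ^ k) v ≡ w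
    glide-transitive (i , false) (j , false) = glide-same-side i j false
    glide-transitive (i , true)  (j , true)  = glide-same-side i j true
    glide-transitive (i , false) (j , true)  = after-one-step (i , false) (glide-same-side (i +ₘ c) j true)
    glide-transitive (i , true)  (j , false) = after-one-step (i , true) (glide-same-side (i +ₘ e) j false)

    glide-circulant : IsCirculant (Adj m x y)
    glide-circulant = glide↔ , glide-automorphism , glide-transitive

  module CyclicAutomorphism (x≢0 : x ≢ 0ₘ) (y≢0 : y ≢ 0ₘ) (x≢y : x ≢ y)
                            (connected : Connected (Adj m x y)) (circulant : IsCirculant (Adj m x y)) where

    g : Vertex m → Vertex m
    g = Inverse.to (proj₁ circulant)

    g-preserves : ∀ {u v} → Adj m x y u v → Adj m x y (g u) (g v)
    g-preserves {u} {v} = proj₁ (proj₁ (proj₂ circulant) u v)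

    g-injective : ∀ {u v} → g u ≡ g v → u ≡ v
    g-injective = Injection.injective (↔⇒↣ (proj₁ circulant))

    open Orbit _≟ᵥ_ g g-injective (proj₂ (proj₂ circulant)) origin
    open Sides proj₂ adj-flips g-preserves

    sides-shift-uniformly : ∀ v → proj₂ (g v) ≡ proj₂ v xor proj₂ (g origin)
    sides-shift-uniformly v = walk-preserves-side-shift (proj₂ (g origin)) (connected origin v) refl

    -- If g kept the sides, (0, 1) would not lie in the orbit of the origin.
    g-flips : ∀ v → proj₂ (g v) ≡ not (proj₂ v)
    g-flips v with proj₂ (g origin) | sides-shift-uniformly
    ... | true  | shift = trans (shift v) (Bool.xor-comm (proj₂ v) true)
    ... | false | shift = contradiction
      (trans (sym (cong proj₂ (^index (0ₘ , true)))) (^-preserves-sides keeps (index (0ₘ , true)) origin)) λ ()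
      where
        keeps : ∀ w → proj₂ (g w) ≡ proj₂ w
        keeps w = trans (shift w) (Bool.xor-identityʳ (proj₂ w))

    ν : ℤₘ → ℕ
    ν t = index (t , true)

    ν-injective : ∀ {a b} → ν a ≡ ν b → a ≡ b
    ν-injective = cong proj₁ ∘ index-injective

    neighbour⇒index∈ : ∀ {w} → Adj m x y origin w → index w ∈ map ν Offsets
    neighbour⇒index∈ {j , true} e with edge⇒offset e
    ... | t , t∈ , j≡0+t =
      subst (λ k → ν k ∈ map ν Offsets) (sym (trans j≡0+t (+ₘ-identityˡ t))) (∈-map⁺ ν t∈)

    index∈⇒neighbour : ∀ {k} → k ∈ map ν Offsets → Adj m x y origin ((g ^ k) origin)
    index∈⇒neighbour k∈ with ∈-map⁻ ν k∈
    ... | t , t∈ , refl = subst (Adj m x y origin) (sym (^index (t , true))) (offset⇒edge t∈ (sym (+ₘ-identityˡ t)))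

    index∈⇒positive : ∀ {k} → k ∈ map ν Offsets → 0 < k
    index∈⇒positive {zero} k∈ with index∈⇒neighbour k∈
    ... | ()
    index∈⇒positive {suc k} _ = s≤s z≤n

    index∈⇒≤period : ∀ {k} → k ∈ map ν Offsets → k ≤ period
    index∈⇒≤period k∈ with ∈-map⁻ ν k∈
    ... | t , _ , refl = <⇒≤ (index<period (t , true))

    -- g^(period − k) maps the edge origin — gᵏ origin to the edge g^(period − k) origin — origin.
    reflection-closed : ∀ {k} → k ∈ map ν Offsets → period ∸ k ∈ map ν Offsets
    reflection-closed {k} k∈ = subst (_∈ map ν Offsets) (index-^ (∸-monoʳ-< (index∈⇒positive k∈) k≤p))
      (neighbour⇒index∈ (adj-sym (subst (Adj m x y _) back-to-origin
        (^-preserves g-preserves (period ∸ k) (index∈⇒neighbour k∈)))))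
      where
        k≤p = index∈⇒≤period k∈
        back-to-origin : (g ^ (period ∸ k)) ((g ^ k) origin) ≡ origin
        back-to-origin = trans (sym (^-+ g (period ∸ k) k origin))
                               (trans (cong (λ i → (g ^ i) origin) (m∸n+n≡m k≤p)) ^period)

    fixed-index≡m : ∀ {k} → k ∈ map ν Offsets → period ∸ k ≡ k → k ≡ m
    fixed-index≡m {k} k∈ p∸k≡k = *-cancelʳ-≡ k m 2 (begin
      k * 2           ≡⟨ trans (*-comm k 2) (cong (k +_) (+-identityʳ k)) ⟩
      k + k           ≡⟨ cong (_+ k) p∸k≡k ⟨
      period ∸ k + k  ≡⟨ m∸n+n≡m (index∈⇒≤period k∈) ⟩
      period          ≡⟨ period≡size Vertex↔Fin ⟩
      m * 2           ∎)
      where open ≡-Reasoning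

    m-odd : ¬ 2 ∣ m
    m-odd (divides q m≡q*2)
      with involution-fixes-one-of-three (period ∸_) (λ k∈ → m∸[m∸n]≡n (index∈⇒≤period k∈))
             (ν0≢ν x≢0) (ν0≢ν y≢0) (x≢y ∘ ν-injective) reflection-closed
      where
        ν0≢ν : ∀ {t} → t ≢ 0ₘ → ν 0ₘ ≢ ν t
        ν0≢ν t≢0 eq = t≢0 (sym (ν-injective eq))
    ... | k , k∈ , p∸k≡k = contradiction (trans (sym (adj-flips (index∈⇒neighbour k∈))) vₘ-on-side-0) λ ()
      where
        vₘ-on-side-0 : proj₂ ((g ^ k) origin) ≡ false
        vₘ-on-side-0 = subst (λ i → proj₂ ((g ^ i) origin) ≡ false)
                         (trans (sym m≡q*2) (sym (fixed-index≡m k∈ p∸k≡k)))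
                         (even-^-preserves-sides g-flips q origin)

    pivot : ℤₘ → Vertex m
    pivot t = (g ^ (ν 0ₘ + ν t)) origin

    pivot-adjacent : ∀ {t} → t ∈ Offsets → Adj m x y (0ₘ , true) (pivot t) × Adj m x y (t , true) (pivot t)
    pivot-adjacent {t} t∈ =
        subst (λ w → Adj m x y w (pivot t)) (^index (0ₘ , true))
          (^-shift-preserves g-preserves (ν 0ₘ) (ν t) (index∈⇒neighbour (∈-map⁺ ν t∈)))
      , subst₂ (Adj m x y) (^index (t , true)) (cong (λ k → (g ^ k) origin) (+-comm (ν t) (ν 0ₘ)))
          (^-shift-preserves g-preserves (ν t) (ν 0ₘ) (index∈⇒neighbour (here refl)))

    pivot-offsets : ∀ {a} → a ∈ Offsets → pivot a ≢ origin →
                    ∃[ s′ ] ∃[ s ] s′ ∈ x ∷ y ∷ [] × s ∈ Offsets × a +ₘ s′ ≡ s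
    pivot-offsets {a} a∈ p≢o with pivot a | pivot-adjacent a∈
    ... | q , false | e₀ , eₐ = common-neighbour e₀ eₐ (p≢o ∘ cong (_, false))
    ... | q , true  | () , _

    pivot-y≢origin : pivot x ≡ origin → pivot y ≢ origin
    pivot-y≢origin px≡o py≡o = x≢y (cong proj₁ (begin
      (x , true)             ≡⟨ ^index (x , true) ⟨
      (g ^ ν x) origin       ≡⟨ ^-injective g-injective (ν 0ₘ) (begin
        (g ^ ν 0ₘ) ((g ^ ν x) origin)  ≡⟨ ^-+ g (ν 0ₘ) (ν x) origin ⟨
        pivot x                        ≡⟨ trans px≡o (sym py≡o) ⟩
        pivot y                        ≡⟨ ^-+ g (ν 0ₘ) (ν y) origin ⟩
        (g ^ ν 0ₘ) ((g ^ ν y) origin)  ∎) ⟩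
      (g ^ ν y) origin       ≡⟨ ^index (y , true) ⟩
      (y , true)             ∎))
      where open ≡-Reasoning

    double-or-negation : DoubleOrNegation x y
    double-or-negation with pivot x ≟ᵥ origin
    ... | no px≢o with pivot-offsets (there (here refl)) px≢o
    ...   | s′ , s , s′∈ , s∈ , eq = offset-sum⇒DoubleOrNegation x≢0 y≢0 x≢y s′∈ s∈ eq
      where open Halving m-odd
    double-or-negation | yes px≡o with pivot-offsets (there (there (here refl))) (pivot-y≢origin px≡o)
    ...   | s′ , s , s′∈ , s∈ , eq = DoubleOrNegation-swap
            (offset-sum⇒DoubleOrNegation y≢0 x≢0 (x≢y ∘ sym)
              (∈-resp-↭ (↭.swap x y ↭.refl) s′∈) (∈-resp-↭ (↭.prep 0ₘ (↭.swap x y ↭.refl)) s∈) eq)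
      where open Halving m-odd

lemma7p1 : (m : ℕ) .{{_ : NonZero m}} → 5 ≤ m → (x y : Fin m) →
    ¬ x ≡ y → ¬ toℕ x ≡ 0 → ¬ toℕ y ≡ 0 →
    Connected (Adj m x y) →
    (IsCirculant (Adj m x y) ⇔
      (¬ (2 ∣ m) × (∃[ a ] (gcd m ∣ a ∣ ≡ 1 ×
        (((x ≡ ι m a × y ≡ dbl m (ι m a)) ⊎ (y ≡ ι m a × x ≡ dbl m (ι m a)))
         ⊎ ((x ≡ ι m a × y ≡ ⊖ m (ι m a)) ⊎ (y ≡ ι m a × x ≡ ⊖ m (ι m a))))))))
lemma7p1 (suc n) 5≤m x y x≢y x≢0 y≢0 connected = mk⇔ circulant⇒ ⇒circulant
  where
    open Haar n x y

    1<m : 1 < suc n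
    1<m = ≤-trans (s≤s (s≤s z≤n)) 5≤m

    Characterisation : Set
    Characterisation = ¬ 2 ∣ suc n × ∃[ a ] (gcd (suc n) ∣ a ∣ ≡ 1 × DoubleOrNegationOf a)

    circulant⇒ : IsCirculant (Adj (suc n) x y) → Characterisation
    circulant⇒ circulant = m-odd , DoubleOrNegation⇒coprime-witness connected 1<m double-or-negation
      where open CyclicAutomorphism (x≢0 ∘ cong toℕ) (y≢0 ∘ cong toℕ) x≢y connected circulant

    ⇒circulant : Characterisation → IsCirculant (Adj (suc n) x y)
    ⇒circulant (m-odd , a , _ , form)
      with DoubleOrNegation⇒symmetric-offsets (DoubleOrNegationOf⇒DoubleOrNegation {a} form)
    ... | d , symmetric = Glide.glide-circulant m-odd d symmetric
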